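{- For every positive integer $n$, $$\Phi^{(4)}[a; b; cq^{ -n}, c'; x, y] = \frac{1}{(q/c; q)_n} \sum_{k=0}^n \begin{bmatrix} n \\ k \end{bmatrix} (-c)^{k-n} q^{\binom{n+1-k}{2}} \Phi^{(4)}[a; b; c, c'; xq^k, y],$$ and $$\Phi^{(4)}[a; b; cq^n, c'; x, y] = \sum_{k=0}^n \begin{bmatrix} n \\ k \end{bmatrix} c^k q^{2\binom{k}{2}} (cq^k; q)_{n-k}\, \Phi^{(4)}[a; b; cq^k, c'; xq^k, y].$$
   Context: Let $q$ be a complex number with $|q|<1$. For a complex number $z$ and an integer $N\ge 0$, $(z;q)_N=\prod_{j=0}^{N-1}(1-zq^j)$. The $q$-binomial coefficient is $\begin{bmatrix} n \\ k \end{bmatrix}=\frac{(q;q)_n}{(q;q)_k(q;q)_{n-k}}$ for $0\le k\le n$, and $\binom{k}{2}=k(k-1)/2$. The $q$-Appell function $\Phi^{(4)}$ is $$\Phi^{(4)}[a; b; c, c'; x, y] = \sum_{m, n \geq 0} \frac{(a; q)_{m+n} (b; q)_{m+n}}{(q; q)_m (q; q)_n (c; q)_m (c'; q)_n} x^m y^n .$$ All identities are understood as identities of power series in $x,y$ (convergent for $|x|,|y|$ sufficiently small), with parameters generic so that no denominator appearing vanishes. -}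

module Defs where

open import Level using (Level; _⊔_) renaming (suc to lsuc)
open import Data.Nat using (ℕ; zero; suc; _∸_) renaming (_*_ to _*ℕ_; _+_ to _+ℕ_)
open import Relation.Nullary using (¬_)
open import Algebra.Bundles using (CommutativeRing)

record Fld (c ℓ : Level) : Set (lsuc (c ⊔ ℓ)) where
  field
    commutativeRing : CommutativeRing c ℓ
  open CommutativeRing commutativeRing public
  field
    _⁻¹     : Carrier → Carrier
    0≉1     : ¬ (0# ≈ 1#)
    inverseʳ : ∀ x → ¬ (x ≈ 0#) → (x * (x ⁻¹)) ≈ 1#

module FieldDefs {c ℓ : Level} (F : Fld c ℓ) where
  open Fld F public hiding (zero)

  infixr 8 _^_
  infixl 7 _÷_
  infix 4 _≋_
  infixr 6 _·_

  _÷_ : Carrier → Carrier → Carrier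
  x ÷ y = x * (y ⁻¹)

  _^_ : Carrier → ℕ → Carrier
  x ^ zero  = 1#
  x ^ suc n = x * (x ^ n)

  poch : Carrier → Carrier → ℕ → Carrier
  poch z q zero    = 1#
  poch z q (suc N) = poch z q N * (1# - z * (q ^ N))

  -- q-binomial coefficient [n k] = (q;q)_n / ((q;q)_k (q;q)_{n-k})  (used for 0 ≤ k ≤ n)
  qbinom : Carrier → ℕ → ℕ → Carrier
  qbinom q n k = poch q q n ÷ (poch q q k * poch q q (n ∸ k))

  sumTo : ℕ → (ℕ → Carrier) → Carrier
  sumTo zero    f = f zero
  sumTo (suc n) f = sumTo n f + f (suc n)

  -- formal power series in two variables x, y: coefficient of x^m y^l
  Series : Set c
  Series = ℕ → ℕ → Carrier

  _≋_ : Series → Series → Set ℓ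
  f ≋ g = ∀ m l → f m l ≈ g m l

  _·_ : Carrier → Series → Series
  (s · f) m l = s * f m l

  sumSeries : ℕ → (ℕ → Series) → Series
  sumSeries n G m l = sumTo n (λ k → G k m l)

  -- substitution x ↦ x q^k :  coefficient of x^m y^l gets multiplied by q^{k m}
  substX : Carrier → ℕ → Series → Series
  substX q k f m l = (q ^ (k *ℕ m)) * f m l

  Φ⁴ : (q a b cc c' : Carrier) → Series
  Φ⁴ q a b cc c' m l =
    (poch a q (m +ℕ l) * poch b q (m +ℕ l))
      ÷ (((poch q q m * poch q q l) * poch cc q m) * poch c' q l)

module Submission where

-- Coefficientwise, Φ⁽⁴⁾[a;b;c,c';x,y] has the coefficient  W(m,l) / (c;q)_m  at xᵐ yˡ,
-- where W does not depend on c, and the substitution x ↦ x qᵏ multiplies it by q^{km}.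
-- Both identities therefore reduce to identities between reciprocals of Pochhammer
-- symbols in the single index m (lemma Φ⁴-expansion):
--   lowering:  (q/c;q)_n / (cq⁻ⁿ;q)_m = Σ_k [n k] (-c)^{k-n} q^{C(n+1-k,2)} q^{km} / (c;q)_m,
--   raising:   1 / (cqⁿ;q)_m         = Σ_k [n k] c^k q^{2C(k,2)} (cqᵏ;q)_{n-k} q^{km} / (cqᵏ;q)_m.
-- Multiplied out, these are consequences of two classical finite q-binomial identities,
-- proved by induction on n from the q-Pascal recurrence of the Gaussian coefficients:
--   (R)  Σ_{k+j=n} [n k] (-w)^k q^{C(j+1,2)} = ∏_{i=1}^{n} (qⁱ - w),
--   (U)  Σ_{k+j=n} [n k] d^k q^{2C(k,2)} (dqᵏ;q)_j = 1.
-- The file first builds a ring solver with integer coefficients, then elementary field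
-- facts, finite and "diagonal" sums, the q-calculus (Pochhammer symbols, Gaussian
-- coefficients, (R) and (U)), the reduction lemma Φ⁴-expansion, the two reciprocal
-- identities, and finally the theorem.

open import Defs
open import Level using (Level)
open import Data.Nat using (ℕ; _≤_; _∸_) renaming (_+_ to _+ℕ_; _*_ to _*ℕ_)
open import Data.Nat.Combinatorics using (_C_)
open import Data.Product using (_×_; _,_)
open import Relation.Nullary using (¬_; yes; no)

open import Algebra.Bundles using (CommutativeRing; RawRing)
open import Data.Nat as N using (zero; suc)
import Data.Nat.Properties as NP
import Data.Nat.Solver
import Data.Nat.Combinatorics as NC
open import Data.Integer as Z using (ℤ; +_; -[1+_])
import Data.Integer.Properties as ZP
open import Data.Maybe using (Maybe; just; nothing)
open import Relation.Binary.PropositionalEquality as P using (_≡_)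
open import Data.Sign as S using (Sign)

-- Integer (rather than natural) coefficients are needed because the identities below
-- involve subtraction and cancellation, e.g.  (1 - a)p + a(1 - b)p = (1 - ab)p.
module IntegerRingSolver {c ℓ : Level} (CR : CommutativeRing c ℓ) where
  open CommutativeRing CR
  open import Algebra.Solver.Ring.AlmostCommutativeRing using (fromCommutativeRing; _-Raw-AlmostCommutative⟶_)
  open import Algebra.Properties.Semiring.Mult.TCOptimised semiring renaming (_×_ to _⊠_)
  open import Algebra.Properties.Ring ring
  open import Relation.Binary.Reasoning.Setoid setoid

  ℤ-rawRing : RawRing _ _
  ℤ-rawRing = record { Carrier = ℤ ; _≈_ = _≡_ ; _+_ = Z._+_ ; _*_ = Z._*_ ; -_ = Z.-_ ; 0# = + 0 ; 1# = + 1 }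

  ⟦_⟧ℤ : ℤ → Carrier
  ⟦ + n ⟧ℤ = n ⊠ 1#
  ⟦ -[1+ n ] ⟧ℤ = - (suc n ⊠ 1#)

  -‿homo : ∀ i → ⟦ Z.- i ⟧ℤ ≈ - ⟦ i ⟧ℤ
  -‿homo (+ zero) = sym -0#≈0#
  -‿homo (+ suc n) = refl
  -‿homo -[1+ n ] = sym (-‿involutive _)

  ⊖-homo : ∀ m n → ⟦ m Z.⊖ n ⟧ℤ ≈ m ⊠ 1# - n ⊠ 1#
  ⊖-homo zero zero = sym (-‿inverseʳ 0#)
  ⊖-homo zero (suc n) = sym (+-identityˡ _)
  ⊖-homo (suc m) zero = trans (sym (+-identityʳ _)) (+-congˡ (sym -0#≈0#))
  ⊖-homo (suc m) (suc n) = begin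
      ⟦ suc m Z.⊖ suc n ⟧ℤ ≈⟨ reflexive (P.cong ⟦_⟧ℤ (ZP.[1+m]⊖[1+n]≡m⊖n m n)) ⟩
      ⟦ m Z.⊖ n ⟧ℤ ≈⟨ ⊖-homo m n ⟩
      m ⊠ 1# - n ⊠ 1# ≈⟨ sym (+-identityʳ _) ⟩
      (m ⊠ 1# - n ⊠ 1#) + 0# ≈⟨ +-congˡ (sym (-‿inverseʳ 1#)) ⟩
      (m ⊠ 1# - n ⊠ 1#) + (1# - 1#) ≈⟨ +-assoc _ _ _ ⟩
      m ⊠ 1# + (- (n ⊠ 1#) + (1# - 1#)) ≈⟨ +-congˡ (+-comm _ _) ⟩
      m ⊠ 1# + ((1# - 1#) - n ⊠ 1#) ≈⟨ +-congˡ (+-assoc _ _ _) ⟩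
      m ⊠ 1# + (1# + (- 1# - n ⊠ 1#)) ≈⟨ sym (+-assoc _ _ _) ⟩
      (m ⊠ 1# + 1#) + (- 1# - n ⊠ 1#) ≈⟨ +-cong (+-comm _ _) (-‿+-comm 1# (n ⊠ 1#)) ⟩
      (1# + m ⊠ 1#) - (1# + n ⊠ 1#) ≈⟨ +-cong (sym (1+× m 1#)) (-‿cong (sym (1+× n 1#))) ⟩
      suc m ⊠ 1# - suc n ⊠ 1# ∎

  +-homo : ∀ i j → ⟦ i Z.+ j ⟧ℤ ≈ ⟦ i ⟧ℤ + ⟦ j ⟧ℤ
  +-homo (+ m) (+ n) = ×-homo-+ 1# m n
  +-homo (+ m) -[1+ n ] = ⊖-homo m (suc n)
  +-homo -[1+ m ] (+ n) = trans (⊖-homo n (suc m)) (+-comm _ _)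
  +-homo -[1+ m ] -[1+ n ] = begin
      - (suc (suc (m N.+ n)) ⊠ 1#) ≈⟨ -‿cong (reflexive (P.cong (_⊠ 1#) (P.sym (NP.+-suc (suc m) n)))) ⟩
      - ((suc m N.+ suc n) ⊠ 1#) ≈⟨ -‿cong (×-homo-+ 1# (suc m) (suc n)) ⟩
      - (suc m ⊠ 1# + suc n ⊠ 1#) ≈⟨ sym (-‿+-comm _ _) ⟩
      - (suc m ⊠ 1#) + - (suc n ⊠ 1#) ∎

  signed : Sign → Carrier → Carrier
  signed S.+ x = x
  signed S.- x = - x

  signed-cong : ∀ s {x y} → x ≈ y → signed s x ≈ signed s y
  signed-cong S.+ e = e
  signed-cong S.- e = -‿cong e

  ⟦⟧ℤ-signed : ∀ i → ⟦ i ⟧ℤ ≈ signed (Z.sign i) (Z.∣ i ∣ ⊠ 1#)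
  ⟦⟧ℤ-signed (+ n) = refl
  ⟦⟧ℤ-signed -[1+ n ] = refl

  ◃-homo : ∀ s n → ⟦ s Z.◃ n ⟧ℤ ≈ signed s (n ⊠ 1#)
  ◃-homo S.+ n = reflexive (P.cong ⟦_⟧ℤ (ZP.+◃n≡+n n))
  ◃-homo S.- n = trans (reflexive (P.cong ⟦_⟧ℤ (ZP.-◃n≡-n n))) (-‿homo (+ n))

  signed-* : ∀ s t x y → signed (s S.* t) (x * y) ≈ signed s x * signed t y
  signed-* S.+ S.+ x y = refl
  signed-* S.+ S.- x y = -‿distribʳ-* x y
  signed-* S.- S.+ x y = -‿distribˡ-* x y
  signed-* S.- S.- x y = begin
      x * y ≈⟨ sym (-‿involutive _) ⟩
      - - (x * y) ≈⟨ -‿cong (-‿distribˡ-* x y) ⟩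
      - (- x * y) ≈⟨ -‿distribʳ-* (- x) y ⟩
      - x * - y ∎

  *-homo : ∀ i j → ⟦ i Z.* j ⟧ℤ ≈ ⟦ i ⟧ℤ * ⟦ j ⟧ℤ
  *-homo i j = begin
      ⟦ i Z.* j ⟧ℤ ≈⟨ ◃-homo (Z.sign i S.* Z.sign j) (Z.∣ i ∣ N.* Z.∣ j ∣) ⟩
      signed (Z.sign i S.* Z.sign j) ((Z.∣ i ∣ N.* Z.∣ j ∣) ⊠ 1#) ≈⟨ signed-cong (Z.sign i S.* Z.sign j) (×1-homo-* Z.∣ i ∣ Z.∣ j ∣) ⟩
      signed (Z.sign i S.* Z.sign j) ((Z.∣ i ∣ ⊠ 1#) * (Z.∣ j ∣ ⊠ 1#)) ≈⟨ signed-* (Z.sign i) (Z.sign j) _ _ ⟩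
      signed (Z.sign i) (Z.∣ i ∣ ⊠ 1#) * signed (Z.sign j) (Z.∣ j ∣ ⊠ 1#) ≈⟨ *-cong (sym (⟦⟧ℤ-signed i)) (sym (⟦⟧ℤ-signed j)) ⟩
      ⟦ i ⟧ℤ * ⟦ j ⟧ℤ ∎

  ℤ-morphism : ℤ-rawRing -Raw-AlmostCommutative⟶ fromCommutativeRing CR
  ℤ-morphism = record
    { ⟦_⟧ = ⟦_⟧ℤ ; +-homo = +-homo ; *-homo = *-homo ; -‿homo = -‿homo
    ; 0-homo = refl ; 1-homo = refl }

  ℤ-equal? : ∀ i j → Maybe (⟦ i ⟧ℤ ≈ ⟦ j ⟧ℤ)
  ℤ-equal? i j with i Z.≟ j
  ... | yes e = just (reflexive (P.cong ⟦_⟧ℤ e))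
  ... | no _ = nothing

  open import Algebra.Solver.Ring ℤ-rawRing (fromCommutativeRing CR) ℤ-morphism ℤ-equal? public

module FieldFacts {ℓc ℓe : Level} (F : Fld ℓc ℓe) where
  open FieldDefs F
  open IntegerRingSolver commutativeRing using (solve; _:=_; _:*_; :-_; con)
  open import Relation.Binary.Reasoning.Setoid setoid

  NZ : Carrier → Set ℓe
  NZ x = ¬ (x ≈ 0#)

  inverseˡ : ∀ {x} → NZ x → x ⁻¹ * x ≈ 1#
  inverseˡ {x} x≠0 = trans (*-comm _ _) (inverseʳ x x≠0)

  nonzero-* : ∀ {x y} → NZ x → NZ y → NZ (x * y)
  nonzero-* {x} {y} x≠0 y≠0 xy≈0 = x≠0 (begin
     x ≈⟨ sym (*-identityʳ x) ⟩
     x * 1# ≈⟨ *-congˡ (sym (inverseʳ y y≠0)) ⟩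
     x * (y * y ⁻¹) ≈⟨ sym (*-assoc _ _ _) ⟩
     (x * y) * y ⁻¹ ≈⟨ *-congʳ xy≈0 ⟩
     0# * y ⁻¹ ≈⟨ zeroˡ _ ⟩
     0# ∎)

  nonzero-- : ∀ {x} → NZ x → NZ (- x)
  nonzero-- {x} x≠0 -x≈0 = x≠0 (begin
     x ≈⟨ solve 1 (λ a → a := :- (:- a)) refl x ⟩
     - (- x) ≈⟨ -‿cong -x≈0 ⟩
     - 0# ≈⟨ solve 0 (:- con (+ 0) := con (+ 0)) refl ⟩
     0# ∎)

  inverse-unique : ∀ {u v} → NZ u → u * v ≈ 1# → u ⁻¹ ≈ v
  inverse-unique {u} {v} u≠0 uv≈1 = begin
     u ⁻¹ ≈⟨ sym (*-identityʳ _) ⟩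
     u ⁻¹ * 1# ≈⟨ *-congˡ (sym uv≈1) ⟩
     u ⁻¹ * (u * v) ≈⟨ sym (*-assoc _ _ _) ⟩
     (u ⁻¹ * u) * v ≈⟨ *-congʳ (inverseˡ u≠0) ⟩
     1# * v ≈⟨ *-identityˡ v ⟩
     v ∎

  *-cancelˡ : ∀ {x a b} → NZ x → x * a ≈ x * b → a ≈ b
  *-cancelˡ {x} {a} {b} x≠0 xa≈xb = begin
     a ≈⟨ sym (*-identityˡ a) ⟩
     1# * a ≈⟨ *-congʳ (sym (inverseˡ x≠0)) ⟩
     (x ⁻¹ * x) * a ≈⟨ *-assoc _ _ _ ⟩
     x ⁻¹ * (x * a) ≈⟨ *-congˡ xa≈xb ⟩
     x ⁻¹ * (x * b) ≈⟨ sym (*-assoc _ _ _) ⟩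
     (x ⁻¹ * x) * b ≈⟨ *-congʳ (inverseˡ x≠0) ⟩
     1# * b ≈⟨ *-identityˡ b ⟩
     b ∎

  reciprocal-from-product : ∀ {y s p z} → NZ y → NZ p → NZ z →
    y * s ≈ p * z → y ⁻¹ ≈ p ⁻¹ * (s * z ⁻¹)
  reciprocal-from-product {y} {s} {p} {z} y≠0 p≠0 z≠0 ys≈pz = inverse-unique y≠0 (begin
    y * (p ⁻¹ * (s * z ⁻¹)) ≈⟨ solve 5 (λ y' p' s' z' t → y' :* (p' :* (s' :* t)) := (p' :* t) :* (y' :* s')) refl y (p ⁻¹) s z (z ⁻¹) ⟩
    (p ⁻¹ * z ⁻¹) * (y * s) ≈⟨ *-congˡ ys≈pz ⟩
    (p ⁻¹ * z ⁻¹) * (p * z) ≈⟨ solve 4 (λ a b x w → (a :* b) :* (x :* w) := (x :* a) :* (w :* b)) refl (p ⁻¹) (z ⁻¹) p z ⟩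
    (p * p ⁻¹) * (z * z ⁻¹) ≈⟨ *-cong (inverseʳ p p≠0) (inverseʳ z z≠0) ⟩
    1# * 1# ≈⟨ *-identityˡ _ ⟩
    1# ∎)

  ÷-split : ∀ a x y z → NZ x → NZ y → NZ z → a ÷ ((x * y) * z) ≈ (a * (x * z) ⁻¹) * y ⁻¹
  ÷-split a x y z x≠0 y≠0 z≠0 = begin
     a * ((x * y) * z) ⁻¹ ≈⟨ *-congˡ (inverse-unique (nonzero-* (nonzero-* x≠0 y≠0) z≠0) product-inverse) ⟩
     a * ((x * z) ⁻¹ * y ⁻¹) ≈⟨ sym (*-assoc _ _ _) ⟩
     (a * (x * z) ⁻¹) * y ⁻¹ ∎
    where
    product-inverse : ((x * y) * z) * ((x * z) ⁻¹ * y ⁻¹) ≈ 1#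
    product-inverse = begin
      ((x * y) * z) * ((x * z) ⁻¹ * y ⁻¹)
        ≈⟨ solve 5 (λ x' y' z' u v → ((x' :* y') :* z') :* (u :* v) := ((x' :* z') :* u) :* (y' :* v)) refl x y z _ _ ⟩
      ((x * z) * (x * z) ⁻¹) * (y * y ⁻¹) ≈⟨ *-cong (inverseʳ _ (nonzero-* x≠0 z≠0)) (inverseʳ _ y≠0) ⟩
      1# * 1# ≈⟨ *-identityˡ _ ⟩
      1# ∎

  ^-congˡ : ∀ n {x y} → x ≈ y → x ^ n ≈ y ^ n
  ^-congˡ zero x≈y = refl
  ^-congˡ (suc n) x≈y = *-cong x≈y (^-congˡ n x≈y)

  ^-congʳ : ∀ x {m n} → m ≡ n → x ^ m ≈ x ^ n
  ^-congʳ x m≡n = reflexive (P.cong (x ^_) m≡n)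

  ^-homo-* : ∀ x m n → x ^ (m +ℕ n) ≈ x ^ m * x ^ n
  ^-homo-* x zero n = sym (*-identityˡ _)
  ^-homo-* x (suc m) n = trans (*-congˡ (^-homo-* x m n)) (sym (*-assoc _ _ _))

  ^-distrib-* : ∀ x y n → (x * y) ^ n ≈ x ^ n * y ^ n
  ^-distrib-* x y zero = sym (*-identityˡ _)
  ^-distrib-* x y (suc n) = trans (*-congˡ (^-distrib-* x y n))
     (solve 4 (λ a b c d → (a :* b) :* (c :* d) := (a :* c) :* (b :* d)) refl x y (x ^ n) (y ^ n))

  -- (x ^ m) ^ k, with the exponent in the order used by substX
  ^-^ : ∀ x m k → (x ^ m) ^ k ≈ x ^ (k *ℕ m)
  ^-^ x m zero = refl
  ^-^ x m (suc k) = trans (*-congˡ (^-^ x m k)) (sym (^-homo-* x m (k *ℕ m)))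

  1^n≈1 : ∀ n → 1# ^ n ≈ 1#
  1^n≈1 zero = refl
  1^n≈1 (suc n) = trans (*-identityˡ _) (1^n≈1 n)

  x^n*[x⁻¹]^n≈1 : ∀ {x} n → NZ x → x ^ n * (x ⁻¹) ^ n ≈ 1#
  x^n*[x⁻¹]^n≈1 {x} n x≠0 = begin
     x ^ n * (x ⁻¹) ^ n ≈⟨ sym (^-distrib-* x (x ⁻¹) n) ⟩
     (x * x ⁻¹) ^ n ≈⟨ ^-congˡ n (inverseʳ x x≠0) ⟩
     1# ^ n ≈⟨ 1^n≈1 n ⟩
     1# ∎

  nonzero-^ : ∀ {x} n → NZ x → NZ (x ^ n)
  nonzero-^ zero x≠0 1≈0 = 0≉1 (sym 1≈0)
  nonzero-^ (suc n) x≠0 = nonzero-* x≠0 (nonzero-^ n x≠0)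

module Sums {ℓc ℓe : Level} (F : Fld ℓc ℓe) where
  open FieldDefs F
  open IntegerRingSolver commutativeRing using (solve; _:=_; _:+_)
  open import Relation.Binary.Reasoning.Setoid setoid

  sumTo-cong : ∀ n {f g} → (∀ k → k ≤ n → f k ≈ g k) → sumTo n f ≈ sumTo n g
  sumTo-cong zero f≈g = f≈g 0 N.z≤n
  sumTo-cong (suc n) f≈g = +-cong (sumTo-cong n (λ k k≤n → f≈g k (NP.m≤n⇒m≤1+n k≤n))) (f≈g (suc n) NP.≤-refl)

  sumTo-*ˡ : ∀ n x f → x * sumTo n f ≈ sumTo n (λ k → x * f k)
  sumTo-*ˡ zero x f = refl
  sumTo-*ˡ (suc n) x f = trans (distribˡ _ _ _) (+-congʳ (sumTo-*ˡ n x f))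

  sumTo-*ʳ : ∀ n x f → sumTo n f * x ≈ sumTo n (λ k → f k * x)
  sumTo-*ʳ zero x f = refl
  sumTo-*ʳ (suc n) x f = trans (distribʳ _ _ _) (+-congʳ (sumTo-*ʳ n x f))

  sumTo-peel : ∀ n f → sumTo (suc n) f ≈ f 0 + sumTo n (λ k → f (suc k))
  sumTo-peel zero f = refl
  sumTo-peel (suc n) f = trans (+-congʳ (sumTo-peel n f)) (+-assoc _ _ _)

  -- diag n f = Σ_{k+j=n} f k j, by recursion on the first index
  diag : ℕ → (ℕ → ℕ → Carrier) → Carrier
  diag zero f = f 0 0
  diag (suc n) f = f 0 (suc n) + diag n (λ k j → f (suc k) j)

  sumTo-diag : ∀ n h → sumTo n (λ k → h k (n ∸ k)) ≈ diag n h
  sumTo-diag zero h = refl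
  sumTo-diag (suc n) h = trans (sumTo-peel n _) (+-congˡ (sumTo-diag n (λ k j → h (suc k) j)))

  diag-cong : ∀ n {f g} → (∀ k j → k +ℕ j ≡ n → f k j ≈ g k j) → diag n f ≈ diag n g
  diag-cong zero f≈g = f≈g 0 0 P.refl
  diag-cong (suc n) f≈g = +-cong (f≈g 0 (suc n) P.refl) (diag-cong n (λ k j e → f≈g (suc k) j (P.cong suc e)))

  diag-+ : ∀ n f g → diag n (λ k j → f k j + g k j) ≈ diag n f + diag n g
  diag-+ zero f g = refl
  diag-+ (suc n) f g = trans (+-congˡ (diag-+ n _ _))
     (solve 4 (λ a b c d → (a :+ b) :+ (c :+ d) := (a :+ c) :+ (b :+ d)) refl _ _ _ _)

  diag-*ˡ : ∀ n x f → x * diag n f ≈ diag n (λ k j → x * f k j)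
  diag-*ˡ zero x f = refl
  diag-*ˡ (suc n) x f = trans (distribˡ _ _ _) (+-congˡ (diag-*ˡ n x _))

  delayK : (ℕ → ℕ → Carrier) → ℕ → ℕ → Carrier
  delayK g zero j = 0#
  delayK g (suc k) j = g k j

  delayJ : (ℕ → ℕ → Carrier) → ℕ → ℕ → Carrier
  delayJ h k zero = 0#
  delayJ h k (suc j) = h k j

  diag-delayK : ∀ n g → diag (suc n) (delayK g) ≈ diag n g
  diag-delayK n g = +-identityˡ _

  diag-delayJ : ∀ n h → diag (suc n) (delayJ h) ≈ diag n h
  diag-delayJ zero h = +-identityʳ _
  diag-delayJ (suc n) h = +-congˡ (trans (diag-cong (suc n) shifted) (diag-delayJ n (λ k j → h (suc k) j)))
    where
    shifted : ∀ k j → k +ℕ j ≡ suc n → delayJ h (suc k) j ≈ delayJ (λ k j → h (suc k) j) k j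
    shifted k zero _ = refl
    shifted k (suc j) _ = refl

  diag-split : ∀ n f g h → (∀ j → f 0 (suc j) ≈ h 0 j) → (∀ k → f (suc k) 0 ≈ g k 0) →
          (∀ k j → f (suc k) (suc j) ≈ g k (suc j) + h (suc k) j) →
          diag (suc n) f ≈ diag n g + diag n h
  diag-split n f g h left bottom interior = begin
     diag (suc n) f ≈⟨ diag-cong (suc n) decompose ⟩
     diag (suc n) (λ k j → delayK g k j + delayJ h k j) ≈⟨ diag-+ (suc n) (delayK g) (delayJ h) ⟩
     diag (suc n) (delayK g) + diag (suc n) (delayJ h) ≈⟨ +-cong (diag-delayK n g) (diag-delayJ n h) ⟩
     diag n g + diag n h ∎
    where
    decompose : ∀ k j → k +ℕ j ≡ suc n → f k j ≈ delayK g k j + delayJ h k j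
    decompose zero zero ()
    decompose zero (suc j) _ = trans (left j) (sym (+-identityˡ _))
    decompose (suc k) zero _ = trans (bottom k) (sym (+-identityʳ _))
    decompose (suc k) (suc j) _ = interior k j

C2-suc : ∀ k → suc k C 2 ≡ k +ℕ k C 2
C2-suc k = P.trans (P.sym (NC.nCk+nC[k+1]≡[n+1]C[k+1] k 1)) (P.cong (_+ℕ k C 2) (NC.nC1≡n k))

module QCalculus {ℓc ℓe : Level} (F : Fld ℓc ℓe) (q : Fld.Carrier F) where
  open FieldDefs F
  open FieldFacts F
  open Sums F
  open IntegerRingSolver commutativeRing using (solve; _:=_; _:+_; _:*_; _:-_; :-_; con)
  open import Relation.Binary.Reasoning.Setoid setoid

  poch-cong : ∀ {z z'} N → z ≈ z' → poch z q N ≈ poch z' q N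
  poch-cong zero e = refl
  poch-cong (suc N) e = *-cong (poch-cong N e) (+-congˡ (-‿cong (*-congʳ e)))

  poch-congʳ : ∀ z {M N} → M ≡ N → poch z q M ≈ poch z q N
  poch-congʳ z M≡N = reflexive (P.cong (poch z q) M≡N)

  poch-front : ∀ z N → poch z q (suc N) ≈ (1# - z) * poch (z * q) q N
  poch-front z zero = solve 1 (λ a → con (+ 1) :* (con (+ 1) :- a :* con (+ 1)) := (con (+ 1) :- a) :* con (+ 1)) refl z
  poch-front z (suc N) = begin
     poch z q (suc N) * (1# - z * (q * q ^ N)) ≈⟨ *-congʳ (poch-front z N) ⟩
     ((1# - z) * poch (z * q) q N) * (1# - z * (q * q ^ N))
       ≈⟨ solve 4 (λ a p b c → ((con (+ 1) :- a) :* p) :* (con (+ 1) :- a :* (b :* c))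
                               := (con (+ 1) :- a) :* (p :* (con (+ 1) :- (a :* b) :* c))) refl z (poch (z * q) q N) q (q ^ N) ⟩
     (1# - z) * poch (z * q) q (suc N) ∎

  poch-split : ∀ z k m → poch z q (k +ℕ m) ≈ poch z q k * poch (z * q ^ k) q m
  poch-split z k zero = trans (poch-congʳ z (NP.+-identityʳ k)) (sym (*-identityʳ _))
  poch-split z k (suc m) = begin
     poch z q (k +ℕ suc m) ≈⟨ poch-congʳ z (NP.+-suc k m) ⟩
     poch z q (k +ℕ m) * (1# - z * q ^ (k +ℕ m)) ≈⟨ *-cong (poch-split z k m) (+-congˡ (-‿cong (*-congˡ (^-homo-* q k m)))) ⟩
     (poch z q k * poch (z * q ^ k) q m) * (1# - z * (q ^ k * q ^ m))
       ≈⟨ solve 5 (λ A B a b c → (A :* B) :* (con (+ 1) :- a :* (b :* c)) := A :* (B :* (con (+ 1) :- (a :* b) :* c))) refl _ _ z (q ^ k) (q ^ m) ⟩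
     poch z q k * poch (z * q ^ k) q (suc m) ∎

  -- (z;q)_j (zqʲ;q)_m = (z;q)_m (zqᵐ;q)_j : both equal (z;q)_{m+j}
  poch-swap : ∀ z j m → poch z q j * poch (z * q ^ j) q m ≈ poch z q m * poch (z * q ^ m) q j
  poch-swap z j m = begin
     poch z q j * poch (z * q ^ j) q m ≈⟨ sym (poch-split z j m) ⟩
     poch z q (j +ℕ m) ≈⟨ poch-congʳ z (NP.+-comm j m) ⟩
     poch z q (m +ℕ j) ≈⟨ poch-split z m j ⟩
     poch z q m * poch (z * q ^ m) q j ∎

  qFactors : ℕ → Carrier → Carrier
  qFactors zero w = 1#
  qFactors (suc n) w = qFactors n w * (q ^ suc n - w)

  qFactors-cong : ∀ n {w w'} → w ≈ w' → qFactors n w ≈ qFactors n w'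
  qFactors-cong zero e = refl
  qFactors-cong (suc n) e = *-cong (qFactors-cong n e) (+-congˡ (-‿cong e))

  q^C2-suc : ∀ j → q ^ (suc (suc j) C 2) ≈ (q * q ^ j) * q ^ (suc j C 2)
  q^C2-suc j = trans (^-congʳ q (C2-suc (suc j))) (^-homo-* q (suc j) (suc j C 2))

  qFactors-poch : ∀ n x → qFactors n (x * q ^ n) ≈ q ^ (suc n C 2) * poch x q n
  qFactors-poch zero x = sym (*-identityˡ _)
  qFactors-poch (suc n) x = begin
     qFactors n (x * (q * q ^ n)) * (q * q ^ n - x * (q * q ^ n))
       ≈⟨ *-congʳ (qFactors-cong n (sym (*-assoc _ _ _))) ⟩
     qFactors n ((x * q) * q ^ n) * (q * q ^ n - x * (q * q ^ n)) ≈⟨ *-congʳ (qFactors-poch n (x * q)) ⟩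
     (q ^ (suc n C 2) * poch (x * q) q n) * (q * q ^ n - x * (q * q ^ n))
       ≈⟨ solve 5 (λ T p a b c → (T :* p) :* (b :* c :- a :* (b :* c)) := ((b :* c) :* T) :* ((con (+ 1) :- a) :* p)) refl _ _ x q (q ^ n) ⟩
     (q ^ suc n * q ^ (suc n C 2)) * ((1# - x) * poch (x * q) q n)
       ≈⟨ *-cong (sym (trans (^-congʳ q (C2-suc (suc n))) (^-homo-* q (suc n) (suc n C 2)))) (sym (poch-front x n)) ⟩
     q ^ (suc (suc n) C 2) * poch x q (suc n) ∎

  qFactors-reflect : ∀ c → NZ c → ∀ n → (- c) ^ n * poch (q ÷ c) q n ≈ qFactors n c
  qFactors-reflect c c≠0 zero = *-identityˡ _
  qFactors-reflect c c≠0 (suc n) = begin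
     ((- c) * (- c) ^ n) * (poch (q * c ⁻¹) q n * (1# - (q * c ⁻¹) * q ^ n))
       ≈⟨ solve 5 (λ m A B u v → (m :* A) :* (B :* (con (+ 1) :- u :* v)) := (A :* B) :* (m :* (con (+ 1) :- u :* v))) refl _ _ _ _ _ ⟩
     ((- c) ^ n * poch (q * c ⁻¹) q n) * ((- c) * (1# - (q * c ⁻¹) * q ^ n))
       ≈⟨ *-cong (qFactors-reflect c c≠0 n) last-factor ⟩
     qFactors n c * (q * q ^ n - c) ∎
    where
    last-factor : (- c) * (1# - (q * c ⁻¹) * q ^ n) ≈ q * q ^ n - c
    last-factor = begin
      (- c) * (1# - (q * c ⁻¹) * q ^ n)
        ≈⟨ solve 4 (λ a i b d → (:- a) :* (con (+ 1) :- (b :* i) :* d) := (b :* d) :* (a :* i) :- a) refl c (c ⁻¹) q (q ^ n) ⟩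
      (q * q ^ n) * (c * c ⁻¹) - c ≈⟨ +-congʳ (*-congˡ (inverseʳ c c≠0)) ⟩
      (q * q ^ n) * 1# - c ≈⟨ +-congʳ (*-identityʳ _) ⟩
      q * q ^ n - c ∎

  -- gauss k j = [k+j, k], defined by the q-Pascal recurrence
  --   [k+j+2, k+1] = [k+j+1, k] + q^{k+1} [k+j+1, k+1]
  gauss : ℕ → ℕ → Carrier
  gauss zero j = 1#
  gauss (suc k) zero = 1#
  gauss (suc k) (suc j) = gauss k (suc j) + q ^ suc k * gauss (suc k) j

  gauss-k0 : ∀ k → gauss k 0 ≈ 1#
  gauss-k0 zero = refl
  gauss-k0 (suc k) = refl

  gauss-factorial : ∀ k j → gauss k j * (poch q q k * poch q q j) ≈ poch q q (k +ℕ j)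
  gauss-factorial zero j = trans (*-identityˡ _) (*-identityˡ _)
  gauss-factorial (suc k) zero = trans (*-identityˡ _) (trans (*-identityʳ _) (poch-congʳ q (P.sym (NP.+-identityʳ (suc k)))))
  gauss-factorial (suc k) (suc j) = begin
     (gauss k (suc j) + q ^ suc k * gauss (suc k) j) * (poch q q (suc k) * poch q q (suc j))
       ≈⟨ solve 8 (λ g1 g2 a b A B Pk Pj →
            ((g1 :+ (a :* b) :* g2) :* ((Pk :* (con (+ 1) :- a :* b)) :* (Pj :* (con (+ 1) :- a :* B))))
            := ((con (+ 1) :- a :* b) :* (g1 :* (Pk :* (Pj :* (con (+ 1) :- a :* B))))
                :+ ((a :* b) :* (con (+ 1) :- a :* B)) :* (g2 :* ((Pk :* (con (+ 1) :- a :* b)) :* Pj))))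
            refl (gauss k (suc j)) (gauss (suc k) j) q (q ^ k) (q ^ k) (q ^ j) (poch q q k) (poch q q j) ⟩
     (1# - q * q ^ k) * (gauss k (suc j) * (poch q q k * poch q q (suc j)))
       + (q * q ^ k) * (1# - q * q ^ j) * (gauss (suc k) j * (poch q q (suc k) * poch q q j))
       ≈⟨ +-cong (*-congˡ (trans (gauss-factorial k (suc j)) (poch-congʳ q (NP.+-suc k j)))) (*-congˡ (gauss-factorial (suc k) j)) ⟩
     (1# - q * q ^ k) * Pkj + (q * q ^ k) * (1# - q * q ^ j) * Pkj
       ≈⟨ solve 4 (λ a b c P' → (con (+ 1) :- a :* b) :* P' :+ (a :* b) :* (con (+ 1) :- a :* c) :* P'
                      := P' :* (con (+ 1) :- a :* (a :* (b :* c)))) refl q (q ^ k) (q ^ j) Pkj ⟩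
     Pkj * (1# - q * (q * (q ^ k * q ^ j)))
       ≈⟨ *-congˡ (+-congˡ (-‿cong (*-congˡ (*-congˡ (sym (^-homo-* q k j)))))) ⟩
     poch q q (suc (suc (k +ℕ j))) ≈⟨ poch-congʳ q (P.cong suc (P.sym (NP.+-suc k j))) ⟩
     poch q q (suc k +ℕ suc j) ∎
    where
    Pkj : Carrier
    Pkj = poch q q (suc (k +ℕ j))

  qbinom≈gauss : (∀ m → NZ (poch q q m)) → ∀ k j → qbinom q (k +ℕ j) k ≈ gauss k j
  qbinom≈gauss [q]≠0 k j = begin
     poch q q (k +ℕ j) * (poch q q k * poch q q (k +ℕ j ∸ k)) ⁻¹
       ≈⟨ *-congˡ (reflexive (P.cong (λ t → (poch q q k * poch q q t) ⁻¹) (NP.m+n∸m≡n k j))) ⟩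
     poch q q (k +ℕ j) * X ⁻¹ ≈⟨ *-congʳ (sym (gauss-factorial k j)) ⟩
     (gauss k j * X) * X ⁻¹ ≈⟨ *-assoc _ _ _ ⟩
     gauss k j * (X * X ⁻¹) ≈⟨ *-congˡ (inverseʳ _ (nonzero-* ([q]≠0 k) ([q]≠0 j))) ⟩
     gauss k j * 1# ≈⟨ *-identityʳ _ ⟩
     gauss k j ∎
    where
    X : Carrier
    X = poch q q k * poch q q j

  binomialTerm : Carrier → ℕ → ℕ → Carrier
  binomialTerm w k j = gauss k j * ((- w) ^ k * q ^ (suc j C 2))

  qBinomialTheorem : ∀ n w → diag n (binomialTerm w) ≈ qFactors n w
  qBinomialTheorem zero w = trans (*-identityˡ _) (*-identityˡ _)
  qBinomialTheorem (suc n) w = begin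
     diag (suc n) (binomialTerm w) ≈⟨ diag-split n (binomialTerm w) g h left bottom interior ⟩
     diag n g + diag n h
       ≈⟨ +-cong (sym (diag-*ˡ n (- w) (binomialTerm w)))
                 (trans (diag-cong n h-on-diagonal) (sym (diag-*ˡ n (q ^ suc n) (binomialTerm w)))) ⟩
     (- w) * diag n (binomialTerm w) + q ^ suc n * diag n (binomialTerm w) ≈⟨ +-cong (*-congˡ (qBinomialTheorem n w)) (*-congˡ (qBinomialTheorem n w)) ⟩
     (- w) * qFactors n w + q ^ suc n * qFactors n w
       ≈⟨ solve 3 (λ a b c → (:- a) :* b :+ c :* b := b :* (c :- a)) refl w (qFactors n w) (q ^ suc n) ⟩
     qFactors n w * (q ^ suc n - w) ∎
    where
    g h : ℕ → ℕ → Carrier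
    g k j = (- w) * binomialTerm w k j
    h k j = q ^ suc (k +ℕ j) * binomialTerm w k j
    h-on-diagonal : ∀ k j → k +ℕ j ≡ n → h k j ≈ q ^ suc n * binomialTerm w k j
    h-on-diagonal k j e = *-congʳ (^-congʳ q (P.cong suc e))
    left : ∀ j → binomialTerm w 0 (suc j) ≈ h 0 j
    left j = begin
      1# * (1# * q ^ (suc (suc j) C 2)) ≈⟨ *-congˡ (*-congˡ (q^C2-suc j)) ⟩
      1# * (1# * ((q * q ^ j) * q ^ (suc j C 2)))
        ≈⟨ solve 3 (λ a b c → con (+ 1) :* (con (+ 1) :* ((a :* b) :* c)) := (a :* b) :* (con (+ 1) :* (con (+ 1) :* c)))
                   refl q (q ^ j) (q ^ (suc j C 2)) ⟩
      h 0 j ∎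
    bottom : ∀ k → binomialTerm w (suc k) 0 ≈ g k 0
    bottom k = begin
      1# * (((- w) * (- w) ^ k) * 1#)
        ≈⟨ solve 2 (λ a b → con (+ 1) :* ((a :* b) :* con (+ 1)) := a :* (con (+ 1) :* (b :* con (+ 1)))) refl (- w) ((- w) ^ k) ⟩
      (- w) * (1# * ((- w) ^ k * 1#)) ≈⟨ *-congˡ (*-congʳ (sym (gauss-k0 k))) ⟩
      g k 0 ∎
    interior : ∀ k j → binomialTerm w (suc k) (suc j) ≈ g k (suc j) + h (suc k) j
    interior k j = begin
      (gauss k (suc j) + q ^ suc k * gauss (suc k) j) * (((- w) * (- w) ^ k) * q ^ (suc (suc j) C 2))
        ≈⟨ *-congˡ (*-congˡ (q^C2-suc j)) ⟩
      (gauss k (suc j) + q ^ suc k * gauss (suc k) j) * (((- w) * (- w) ^ k) * ((q * q ^ j) * q ^ (suc j C 2)))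
        ≈⟨ solve 8 (λ g1 g2 a b c m M T →
             (g1 :+ (a :* b) :* g2) :* ((m :* M) :* ((a :* c) :* T))
             := m :* (g1 :* (M :* ((a :* c) :* T))) :+ (a :* (a :* (b :* c))) :* (g2 :* ((m :* M) :* T)))
             refl (gauss k (suc j)) (gauss (suc k) j) q (q ^ k) (q ^ j) (- w) ((- w) ^ k) (q ^ (suc j C 2)) ⟩
      (- w) * (gauss k (suc j) * ((- w) ^ k * ((q * q ^ j) * q ^ (suc j C 2)))) + (q * (q * (q ^ k * q ^ j))) * binomialTerm w (suc k) j
        ≈⟨ +-cong (*-congˡ (*-congˡ (*-congˡ (sym (q^C2-suc j))))) (*-congʳ (*-congˡ (*-congˡ (sym (^-homo-* q k j))))) ⟩
      g k (suc j) + h (suc k) j ∎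

  E : ℕ → ℕ
  E k = 2 *ℕ (k C 2)

  q^E-suc : ∀ k → q ^ E (suc k) ≈ q ^ E k * (q ^ k * q ^ k)
  q^E-suc k = trans (^-congʳ q E-suc) (trans (^-homo-* q (E k) (k +ℕ k)) (*-congˡ (^-homo-* q k k)))
    where
    open Data.Nat.Solver.+-*-Solver using () renaming (solve to ℕ-solve; _:=_ to _:=ℕ_; _:+_ to _:+ℕ_; _:*_ to _:*ℕ_; con to conℕ)
    E-suc : E (suc k) ≡ E k +ℕ (k +ℕ k)
    E-suc = P.trans (P.cong (2 *ℕ_) (C2-suc k))
      (ℕ-solve 2 (λ a c → conℕ 2 :*ℕ (a :+ℕ c) :=ℕ conℕ 2 :*ℕ c :+ℕ (a :+ℕ a)) P.refl k (k C 2))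

  unityTerm : Carrier → ℕ → ℕ → Carrier
  unityTerm d k j = gauss k j * ((d ^ k * q ^ E k) * poch (d * q ^ k) q j)

  qBinomialUnity : ∀ n d → diag n (unityTerm d) ≈ 1#
  qBinomialUnity zero d = solve 0 (con (+ 1) :* ((con (+ 1) :* con (+ 1)) :* con (+ 1)) := con (+ 1)) refl
  qBinomialUnity (suc n) d = begin
     diag (suc n) (unityTerm d) ≈⟨ diag-split n (unityTerm d) g h left bottom interior ⟩
     diag n g + diag n h ≈⟨ sym (diag-+ n g h) ⟩
     diag n (λ k j → g k j + h k j) ≈⟨ diag-cong n (λ k j _ → g+h k j) ⟩
     diag n (unityTerm (d * q)) ≈⟨ qBinomialUnity n (d * q) ⟩
     1# ∎
    where
    g h : ℕ → ℕ → Carrier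
    g k j = gauss k j * ((d ^ suc k * q ^ E (suc k)) * poch (d * q ^ suc k) q j)
    h k j = q ^ k * (gauss k j * ((d ^ k * q ^ E k) * ((1# - d * q ^ k) * poch (d * q ^ suc k) q j)))
    front : ∀ k j → poch (d * q ^ k) q (suc j) ≈ (1# - d * q ^ k) * poch (d * q ^ suc k) q j
    front k j = trans (poch-front (d * q ^ k) j) (*-congˡ (poch-cong j (trans (*-assoc d (q ^ k) q) (*-congˡ (*-comm (q ^ k) q)))))
    left : ∀ j → unityTerm d 0 (suc j) ≈ h 0 j
    left j = begin
      1# * ((1# * 1#) * poch (d * 1#) q (suc j)) ≈⟨ *-congˡ (*-congˡ (front 0 j)) ⟩
      1# * ((1# * 1#) * ((1# - d * 1#) * poch (d * q ^ 1) q j))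
        ≈⟨ solve 2 (λ a b → con (+ 1) :* ((con (+ 1) :* con (+ 1)) :* ((con (+ 1) :- a :* con (+ 1)) :* b))
              := con (+ 1) :* (con (+ 1) :* ((con (+ 1) :* con (+ 1)) :* ((con (+ 1) :- a :* con (+ 1)) :* b)))) refl d (poch (d * q ^ 1) q j) ⟩
      h 0 j ∎
    bottom : ∀ k → unityTerm d (suc k) 0 ≈ g k 0
    bottom k = sym (*-congʳ (gauss-k0 k))
    interior : ∀ k j → unityTerm d (suc k) (suc j) ≈ g k (suc j) + h (suc k) j
    interior k j = begin
      (gauss k (suc j) + q ^ suc k * gauss (suc k) j) * ((d ^ suc k * q ^ E (suc k)) * poch (d * q ^ suc k) q (suc j))
        ≈⟨ solve 4 (λ g1 g2 Q X → (g1 :+ Q :* g2) :* X := g1 :* X :+ Q :* (g2 :* X)) refl _ _ _ _ ⟩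
      g k (suc j) + q ^ suc k * (gauss (suc k) j * ((d ^ suc k * q ^ E (suc k)) * poch (d * q ^ suc k) q (suc j)))
        ≈⟨ +-congˡ (*-congˡ (*-congˡ (*-congˡ (front (suc k) j)))) ⟩
      g k (suc j) + h (suc k) j ∎
    g+h : ∀ k j → g k j + h k j ≈ unityTerm (d * q) k j
    g+h k j = begin
      g k j + h k j
        ≈⟨ +-congʳ (*-congˡ (*-congʳ (*-congˡ (q^E-suc k)))) ⟩
      gauss k j * ((d * d ^ k * (q ^ E k * (q ^ k * q ^ k))) * poch (d * q ^ suc k) q j) + h k j
        ≈⟨ solve 6 (λ G a A B b p →
             G :* ((a :* A :* (B :* (b :* b))) :* p) :+ b :* (G :* ((A :* B) :* ((con (+ 1) :- a :* b) :* p)))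
             := G :* (((A :* b) :* B) :* p)) refl (gauss k j) d (d ^ k) (q ^ E k) (q ^ k) (poch (d * q ^ suc k) q j) ⟩
      gauss k j * (((d ^ k * q ^ k) * q ^ E k) * poch (d * q ^ suc k) q j)
        ≈⟨ *-congˡ (*-cong (*-congʳ (sym (^-distrib-* d q k))) (poch-cong j (sym (*-assoc d q (q ^ k))))) ⟩
      unityTerm (d * q) k j ∎

-- Φ⁽⁴⁾ depends on its parameter c only through the factor 1/(c;q)_m of its coefficients,
-- so an expansion of 1/(c;q)_m as a combination of q^{km}/(c_k;q)_m lifts to Φ⁽⁴⁾.
module Φ⁴Expansion {ℓc ℓe : Level} (F : Fld ℓc ℓe) where
  open FieldDefs F
  open FieldFacts F
  open Sums F
  open IntegerRingSolver commutativeRing using (solve; _:=_; _:*_)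
  open import Relation.Binary.Reasoning.Setoid setoid

  Φ⁴-weight : (q a b c' : Carrier) → ℕ → ℕ → Carrier
  Φ⁴-weight q a b c' m l = (poch a q (m +ℕ l) * poch b q (m +ℕ l)) * ((poch q q m * poch q q l) * poch c' q l) ⁻¹

  Φ⁴-factor : ∀ q a b cc c' m l → NZ (poch q q m) → NZ (poch q q l) → NZ (poch cc q m) → NZ (poch c' q l) →
    Φ⁴ q a b cc c' m l ≈ Φ⁴-weight q a b c' m l * (poch cc q m) ⁻¹
  Φ⁴-factor q a b cc c' m l [q]m≠0 [q]l≠0 [cc]≠0 [c']≠0 =
    ÷-split _ (poch q q m * poch q q l) (poch cc q m) (poch c' q l) (nonzero-* [q]m≠0 [q]l≠0) [cc]≠0 [c']≠0

  Φ⁴-expansion : ∀ (q a b cc c' : Carrier) n (λ₀ : Carrier) (s cs : ℕ → Carrier) →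
    (∀ m → NZ (poch q q m)) → (∀ m → NZ (poch c' q m)) → (∀ m → NZ (poch cc q m)) →
    (∀ k → k ≤ n → ∀ m → NZ (poch (cs k) q m)) →
    (∀ m → (poch cc q m) ⁻¹ ≈ λ₀ * sumTo n (λ k → s k * (q ^ (k *ℕ m) * (poch (cs k) q m) ⁻¹))) →
    Φ⁴ q a b cc c' ≋ λ₀ · sumSeries n (λ k → s k · substX q k (Φ⁴ q a b (cs k) c'))
  Φ⁴-expansion q a b cc c' n λ₀ s cs [q]≠0 [c']≠0 [cc]≠0 [cs]≠0 reciprocal m l = begin
    Φ⁴ q a b cc c' m l ≈⟨ Φ⁴-factor q a b cc c' m l ([q]≠0 m) ([q]≠0 l) ([cc]≠0 m) ([c']≠0 l) ⟩
    W * (poch cc q m) ⁻¹ ≈⟨ *-congˡ (reciprocal m) ⟩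
    W * (λ₀ * sumTo n (λ k → s k * (Q k * Y k))) ≈⟨ solve 3 (λ w x y → w :* (x :* y) := x :* (y :* w)) refl W λ₀ _ ⟩
    λ₀ * (sumTo n (λ k → s k * (Q k * Y k)) * W) ≈⟨ *-congˡ (sumTo-*ʳ n W _) ⟩
    λ₀ * sumTo n (λ k → (s k * (Q k * Y k)) * W) ≈⟨ *-congˡ (sumTo-cong n termwise) ⟩
    λ₀ * sumTo n (λ k → s k * (Q k * Φ⁴ q a b (cs k) c' m l)) ∎
    where
    W : Carrier
    W = Φ⁴-weight q a b c' m l
    Q : ℕ → Carrier
    Q k = q ^ (k *ℕ m)
    Y : ℕ → Carrier
    Y k = (poch (cs k) q m) ⁻¹
    termwise : ∀ k → k ≤ n → (s k * (Q k * Y k)) * W ≈ s k * (Q k * Φ⁴ q a b (cs k) c' m l)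
    termwise k k≤n = begin
      (s k * (Q k * Y k)) * W ≈⟨ solve 4 (λ x y u w → (x :* (y :* u)) :* w := x :* (y :* (w :* u))) refl _ _ _ _ ⟩
      s k * (Q k * (W * Y k)) ≈⟨ *-congˡ (*-congˡ (sym (Φ⁴-factor q a b (cs k) c' m l ([q]≠0 m) ([q]≠0 l) ([cs]≠0 k k≤n m) ([c']≠0 l)))) ⟩
      s k * (Q k * Φ⁴ q a b (cs k) c' m l) ∎

-- Multiplied by (-c)ⁿ, the sum becomes ∏_{i=1}^{n} (qⁱ - cqᵐ) by (R), and
-- (e;q)_m ∏_{i=1}^{n} (qⁱ - eqⁿ⁺ᵐ) = q^{C(n+1,2)} (e;q)_{m+n} = ∏_{i=1}^{n} (qⁱ - c) (c;q)_m.
module Lowering {ℓc ℓe : Level} (F : Fld ℓc ℓe) where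
  open FieldDefs F
  open FieldFacts F
  open Sums F
  open IntegerRingSolver commutativeRing using (solve; _:=_; _:*_; :-_)
  open import Relation.Binary.Reasoning.Setoid setoid

  module _ (q c : Carrier) where
    open QCalculus F q

    lowerCoeff : ℕ → ℕ → Carrier
    lowerCoeff N k = qbinom q N k * ((((- c) ⁻¹) ^ (N ∸ k)) * (q ^ ((N +ℕ 1 ∸ k) C 2)))

    lowerCoeff-binomialTerm : (∀ m → NZ (poch q q m)) → NZ c → ∀ m k j →
       (- c) ^ (k +ℕ j) * (lowerCoeff (k +ℕ j) k * q ^ (k *ℕ m)) ≈ binomialTerm (c * q ^ m) k j
    lowerCoeff-binomialTerm [q]≠0 c≠0 m k j = begin
       (- c) ^ (k +ℕ j) * ((qbinom q (k +ℕ j) k * (((- c) ⁻¹) ^ (k +ℕ j ∸ k) * q ^ ((k +ℕ j +ℕ 1 ∸ k) C 2))) * Qm)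
         ≈⟨ reflexive (P.cong₂ (λ u v → (- c) ^ (k +ℕ j) * ((qbinom q (k +ℕ j) k * (((- c) ⁻¹) ^ u * q ^ (v C 2))) * Qm))
                               (NP.m+n∸m≡n k j) k+j+1∸k≡1+j) ⟩
       (- c) ^ (k +ℕ j) * ((qbinom q (k +ℕ j) k * (((- c) ⁻¹) ^ j * T)) * Qm)
         ≈⟨ *-cong (^-homo-* (- c) k j) (*-congʳ (*-congʳ (qbinom≈gauss [q]≠0 k j))) ⟩
       ((- c) ^ k * (- c) ^ j) * ((gauss k j * (((- c) ⁻¹) ^ j * T)) * Qm)
         ≈⟨ solve 6 (λ A B g I t Q → (A :* B) :* ((g :* (I :* t)) :* Q) := (g :* ((A :* Q) :* t)) :* (B :* I))
              refl ((- c) ^ k) ((- c) ^ j) (gauss k j) (((- c) ⁻¹) ^ j) T Qm ⟩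
       (gauss k j * (((- c) ^ k * Qm) * T)) * ((- c) ^ j * ((- c) ⁻¹) ^ j) ≈⟨ *-congˡ (x^n*[x⁻¹]^n≈1 j (nonzero-- c≠0)) ⟩
       (gauss k j * (((- c) ^ k * Qm) * T)) * 1# ≈⟨ *-identityʳ _ ⟩
       gauss k j * (((- c) ^ k * Qm) * T) ≈⟨ *-congˡ (*-congʳ (sym [-cqᵐ]ᵏ)) ⟩
       binomialTerm (c * q ^ m) k j ∎
      where
      T Qm : Carrier
      T = q ^ (suc j C 2)
      Qm = q ^ (k *ℕ m)
      k+j+1∸k≡1+j : k +ℕ j +ℕ 1 ∸ k ≡ suc j
      k+j+1∸k≡1+j = P.trans (P.cong (_∸ k) (NP.+-assoc k j 1)) (P.trans (NP.m+n∸m≡n k (j +ℕ 1)) (NP.+-comm j 1))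
      [-cqᵐ]ᵏ : (- (c * q ^ m)) ^ k ≈ (- c) ^ k * Qm
      [-cqᵐ]ᵏ = begin
        (- (c * q ^ m)) ^ k ≈⟨ ^-congˡ k (solve 2 (λ x y → :- (x :* y) := (:- x) :* y) refl c (q ^ m)) ⟩
        ((- c) * q ^ m) ^ k ≈⟨ ^-distrib-* (- c) (q ^ m) k ⟩
        (- c) ^ k * (q ^ m) ^ k ≈⟨ *-congˡ (^-^ q m k) ⟩
        (- c) ^ k * Qm ∎

    lowerSum : ℕ → ℕ → Carrier
    lowerSum n m = sumTo n (λ k → lowerCoeff n k * q ^ (k *ℕ m))

    lowerSum-qFactors : (∀ m → NZ (poch q q m)) → NZ c → ∀ n m → (- c) ^ n * lowerSum n m ≈ qFactors n (c * q ^ m)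
    lowerSum-qFactors [q]≠0 c≠0 n m = begin
      (- c) ^ n * lowerSum n m ≈⟨ sumTo-*ˡ n _ _ ⟩
      sumTo n (λ k → (- c) ^ n * (lowerCoeff n k * q ^ (k *ℕ m)))
        ≈⟨ sumTo-cong n (λ k k≤n → P.subst (λ N → (- c) ^ N * (lowerCoeff N k * q ^ (k *ℕ m)) ≈ binomialTerm (c * q ^ m) k (n ∸ k))
                                          (NP.m+[n∸m]≡n k≤n) (lowerCoeff-binomialTerm [q]≠0 c≠0 m k (n ∸ k))) ⟩
      sumTo n (λ k → binomialTerm (c * q ^ m) k (n ∸ k)) ≈⟨ sumTo-diag n _ ⟩
      diag n (binomialTerm (c * q ^ m)) ≈⟨ qBinomialTheorem n _ ⟩
      qFactors n (c * q ^ m) ∎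

    module _ (n : ℕ) where
      e : Carrier
      e = c * ((q ⁻¹) ^ n)

      eqⁿ≈c : NZ q → e * q ^ n ≈ c
      eqⁿ≈c q≠0 = begin
        (c * (q ⁻¹) ^ n) * q ^ n ≈⟨ *-assoc _ _ _ ⟩
        c * ((q ⁻¹) ^ n * q ^ n) ≈⟨ *-congˡ (*-comm _ _) ⟩
        c * (q ^ n * (q ⁻¹) ^ n) ≈⟨ *-congˡ (x^n*[x⁻¹]^n≈1 n q≠0) ⟩
        c * 1# ≈⟨ *-identityʳ _ ⟩
        c ∎

      poch-lowerSum : NZ q → NZ c → (∀ m → NZ (poch q q m)) → ∀ m → poch e q m * lowerSum n m ≈ poch (q ÷ c) q n * poch c q m
      poch-lowerSum q≠0 c≠0 [q]≠0 m = *-cancelˡ (nonzero-^ n (nonzero-- c≠0)) (begin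
        (- c) ^ n * (poch e q m * lowerSum n m) ≈⟨ solve 3 (λ x y z → x :* (y :* z) := y :* (x :* z)) refl _ _ _ ⟩
        poch e q m * ((- c) ^ n * lowerSum n m) ≈⟨ *-congˡ (lowerSum-qFactors [q]≠0 c≠0 n m) ⟩
        poch e q m * qFactors n (c * q ^ m) ≈⟨ *-congˡ (qFactors-cong n cqᵐ≈eqᵐqⁿ) ⟩
        poch e q m * qFactors n ((e * q ^ m) * q ^ n) ≈⟨ *-congˡ (qFactors-poch n _) ⟩
        poch e q m * (q ^ (suc n C 2) * poch (e * q ^ m) q n) ≈⟨ solve 3 (λ x y z → x :* (y :* z) := y :* (x :* z)) refl _ _ _ ⟩
        q ^ (suc n C 2) * (poch e q m * poch (e * q ^ m) q n) ≈⟨ *-congˡ (poch-swap e m n) ⟩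
        q ^ (suc n C 2) * (poch e q n * poch (e * q ^ n) q m) ≈⟨ sym (*-assoc _ _ _) ⟩
        (q ^ (suc n C 2) * poch e q n) * poch (e * q ^ n) q m ≈⟨ *-congʳ (sym (qFactors-poch n e)) ⟩
        qFactors n (e * q ^ n) * poch (e * q ^ n) q m ≈⟨ *-cong (qFactors-cong n (eqⁿ≈c q≠0)) (poch-cong m (eqⁿ≈c q≠0)) ⟩
        qFactors n c * poch c q m ≈⟨ *-congʳ (sym (qFactors-reflect c c≠0 n)) ⟩
        ((- c) ^ n * poch (q ÷ c) q n) * poch c q m ≈⟨ *-assoc _ _ _ ⟩
        (- c) ^ n * (poch (q ÷ c) q n * poch c q m) ∎)
        where
        cqᵐ≈eqᵐqⁿ : c * q ^ m ≈ (e * q ^ m) * q ^ n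
        cqᵐ≈eqᵐqⁿ = begin
          c * q ^ m ≈⟨ *-congʳ (sym (eqⁿ≈c q≠0)) ⟩
          (e * q ^ n) * q ^ m ≈⟨ solve 3 (λ x y z → (x :* y) :* z := (x :* z) :* y) refl _ _ _ ⟩
          (e * q ^ m) * q ^ n ∎

      lowerReciprocal : NZ q → NZ c → (∀ m → NZ (poch q q m)) → (∀ m → NZ (poch c q m)) →
        (∀ m → NZ (poch e q m)) → NZ (poch (q ÷ c) q n) →
        ∀ m → (poch e q m) ⁻¹ ≈ (poch (q ÷ c) q n) ⁻¹ * sumTo n (λ k → lowerCoeff n k * (q ^ (k *ℕ m) * (poch c q m) ⁻¹))
      lowerReciprocal q≠0 c≠0 [q]≠0 [c]≠0 [e]≠0 [q/c]≠0 m = begin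
        (poch e q m) ⁻¹ ≈⟨ reciprocal-from-product ([e]≠0 m) [q/c]≠0 ([c]≠0 m) (poch-lowerSum q≠0 c≠0 [q]≠0 m) ⟩
        (poch (q ÷ c) q n) ⁻¹ * (lowerSum n m * (poch c q m) ⁻¹) ≈⟨ *-congˡ (sumTo-*ʳ n _ _) ⟩
        (poch (q ÷ c) q n) ⁻¹ * sumTo n (λ k → (lowerCoeff n k * q ^ (k *ℕ m)) * (poch c q m) ⁻¹)
          ≈⟨ *-congˡ (sumTo-cong n (λ k _ → *-assoc _ _ _)) ⟩
        (poch (q ÷ c) q n) ⁻¹ * sumTo n (λ k → lowerCoeff n k * (q ^ (k *ℕ m) * (poch c q m) ⁻¹)) ∎

-- Raising: 1/(cqⁿ;q)_m = Σ_k [n k] c^k q^{2C(k,2)} (cqᵏ;q)_{n-k} q^{km} / (cqᵏ;q)_m.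
-- Multiplied by (cqⁿ;q)_m, the k-th term becomes the k-th term of (U) with d = cqᵐ.
module Raising {ℓc ℓe : Level} (F : Fld ℓc ℓe) where
  open FieldDefs F
  open FieldFacts F
  open Sums F
  open IntegerRingSolver commutativeRing using (solve; _:=_; _:*_)
  open import Relation.Binary.Reasoning.Setoid setoid

  module _ (q c : Carrier) where
    open QCalculus F q

    raiseCoeff : ℕ → ℕ → Carrier
    raiseCoeff N k = qbinom q N k * (((c ^ k) * (q ^ (2 *ℕ (k C 2)))) * poch (c * (q ^ k)) q (N ∸ k))

    poch-ratio : ∀ k j m → NZ (poch (c * q ^ k) q m) →
      (poch (c * q ^ k) q j * poch (c * q ^ (k +ℕ j)) q m) * (poch (c * q ^ k) q m) ⁻¹ ≈ poch ((c * q ^ m) * q ^ k) q j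
    poch-ratio k j m [cqᵏ]≠0 = begin
      (poch z q j * poch (c * q ^ (k +ℕ j)) q m) * Y ⁻¹
        ≈⟨ *-congʳ (*-congˡ (poch-cong m (trans (*-congˡ (^-homo-* q k j)) (sym (*-assoc _ _ _))))) ⟩
      (poch z q j * poch (z * q ^ j) q m) * Y ⁻¹ ≈⟨ *-congʳ (poch-swap z j m) ⟩
      (Y * poch (z * q ^ m) q j) * Y ⁻¹ ≈⟨ solve 3 (λ y p i → (y :* p) :* i := p :* (y :* i)) refl Y _ _ ⟩
      poch (z * q ^ m) q j * (Y * Y ⁻¹) ≈⟨ *-congˡ (inverseʳ Y [cqᵏ]≠0) ⟩
      poch (z * q ^ m) q j * 1# ≈⟨ *-identityʳ _ ⟩
      poch (z * q ^ m) q j ≈⟨ poch-cong j (solve 3 (λ x y w → (x :* y) :* w := (x :* w) :* y) refl c (q ^ k) (q ^ m)) ⟩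
      poch ((c * q ^ m) * q ^ k) q j ∎
      where
      z Y : Carrier
      z = c * q ^ k
      Y = poch z q m

    raiseCoeff-unityTerm : (∀ m → NZ (poch q q m)) → ∀ m k j → NZ (poch (c * q ^ k) q m) →
       poch (c * q ^ (k +ℕ j)) q m * (raiseCoeff (k +ℕ j) k * (q ^ (k *ℕ m) * (poch (c * q ^ k) q m) ⁻¹))
         ≈ unityTerm (c * q ^ m) k j
    raiseCoeff-unityTerm [q]≠0 m k j [cqᵏ]≠0 = begin
       Yₙ * ((qbinom q (k +ℕ j) k * (X * poch z q (k +ℕ j ∸ k))) * (Qm * Y ⁻¹))
         ≈⟨ *-congˡ (*-congʳ (*-cong (qbinom≈gauss [q]≠0 k j) (*-congˡ (poch-congʳ z (NP.m+n∸m≡n k j))))) ⟩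
       Yₙ * ((gauss k j * (X * poch z q j)) * (Qm * Y ⁻¹))
         ≈⟨ solve 6 (λ y g x p Q i → y :* ((g :* (x :* p)) :* (Q :* i)) := g :* ((x :* Q) :* ((p :* y) :* i)))
              refl Yₙ (gauss k j) X (poch z q j) Qm _ ⟩
       gauss k j * ((X * Qm) * ((poch z q j * Yₙ) * Y ⁻¹)) ≈⟨ *-congˡ (*-congˡ (poch-ratio k j m [cqᵏ]≠0)) ⟩
       gauss k j * ((X * Qm) * poch ((c * q ^ m) * q ^ k) q j)
         ≈⟨ *-congˡ (*-congʳ (solve 3 (λ a b Q → (a :* b) :* Q := (a :* Q) :* b) refl (c ^ k) (q ^ E k) Qm)) ⟩
       gauss k j * (((c ^ k * Qm) * q ^ E k) * poch ((c * q ^ m) * q ^ k) q j)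
         ≈⟨ *-congˡ (*-congʳ (*-congʳ (sym [cqᵐ]ᵏ))) ⟩
       unityTerm (c * q ^ m) k j ∎
      where
      z X Qm Y Yₙ : Carrier
      z = c * q ^ k
      X = c ^ k * q ^ E k
      Qm = q ^ (k *ℕ m)
      Y = poch z q m
      Yₙ = poch (c * q ^ (k +ℕ j)) q m
      [cqᵐ]ᵏ : (c * q ^ m) ^ k ≈ c ^ k * Qm
      [cqᵐ]ᵏ = trans (^-distrib-* c (q ^ m) k) (*-congˡ (^-^ q m k))

    raiseReciprocal : ∀ n → (∀ m → NZ (poch q q m)) → (∀ k → k ≤ n → ∀ m → NZ (poch (c * q ^ k) q m)) →
      ∀ m → (poch (c * q ^ n) q m) ⁻¹ ≈ sumTo n (λ k → raiseCoeff n k * (q ^ (k *ℕ m) * (poch (c * q ^ k) q m) ⁻¹))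
    raiseReciprocal n [q]≠0 [cqᵏ]≠0 m = inverse-unique ([cqᵏ]≠0 n NP.≤-refl m) (begin
      poch (c * q ^ n) q m * sumTo n term ≈⟨ sumTo-*ˡ n _ _ ⟩
      sumTo n (λ k → poch (c * q ^ n) q m * term k)
        ≈⟨ sumTo-cong n (λ k k≤n → P.subst (λ N → poch (c * q ^ N) q m * (raiseCoeff N k * (q ^ (k *ℕ m) * (poch (c * q ^ k) q m) ⁻¹))
                                                  ≈ unityTerm (c * q ^ m) k (n ∸ k))
                                          (NP.m+[n∸m]≡n k≤n) (raiseCoeff-unityTerm [q]≠0 m k (n ∸ k) ([cqᵏ]≠0 k k≤n m))) ⟩
      sumTo n (λ k → unityTerm (c * q ^ m) k (n ∸ k)) ≈⟨ sumTo-diag n _ ⟩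
      diag n (unityTerm (c * q ^ m)) ≈⟨ qBinomialUnity n _ ⟩
      1# ∎)
      where
      term : ℕ → Carrier
      term k = raiseCoeff n k * (q ^ (k *ℕ m) * (poch (c * q ^ k) q m) ⁻¹)

theorem16 : ∀ {ℓc ℓe : Level} (F : Fld ℓc ℓe) → let open FieldDefs F in
    (q a b c c' : Carrier) (n : ℕ) → 1 ≤ n →
    ¬ (q ≈ 0#) → ¬ (c ≈ 0#) →
    (∀ m → ¬ (poch q q m ≈ 0#)) →
    (∀ m → ¬ (poch c q m ≈ 0#)) →
    (∀ m → ¬ (poch c' q m ≈ 0#)) →
    (∀ m → ¬ (poch (c * ((q ⁻¹) ^ n)) q m ≈ 0#)) →
    ¬ (poch (q ÷ c) q n ≈ 0#) →
    (∀ k → k ≤ n → ∀ m → ¬ (poch (c * (q ^ k)) q m ≈ 0#)) →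
    (Φ⁴ q a b (c * ((q ⁻¹) ^ n)) c'
       ≋ (((poch (q ÷ c) q n) ⁻¹) ·
          sumSeries n (λ k →
            (qbinom q n k * ((((- c) ⁻¹) ^ (n ∸ k)) * (q ^ ((n +ℕ 1 ∸ k) C 2))))
              · substX q k (Φ⁴ q a b c c'))))
    ×
    (Φ⁴ q a b (c * (q ^ n)) c'
       ≋ sumSeries n (λ k →
           (qbinom q n k * (((c ^ k) * (q ^ (2 *ℕ (k C 2)))) * poch (c * (q ^ k)) q (n ∸ k)))
             · substX q k (Φ⁴ q a b (c * (q ^ k)) c')))
theorem16 F q a b c c' n _ q≠0 c≠0 [q]≠0 [c]≠0 [c']≠0 [cq⁻ⁿ]≠0 [q/c]≠0 [cqᵏ]≠0 = lowering , raising
  where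
  open FieldDefs F
  open Φ⁴Expansion F using (Φ⁴-expansion)
  open Lowering F using (lowerCoeff; lowerReciprocal)
  open Raising F using (raiseCoeff; raiseReciprocal)

  lowering : Φ⁴ q a b (c * ((q ⁻¹) ^ n)) c'
               ≋ (poch (q ÷ c) q n) ⁻¹ · sumSeries n (λ k → lowerCoeff q c n k · substX q k (Φ⁴ q a b c c'))
  lowering = Φ⁴-expansion q a b _ c' n _ (lowerCoeff q c n) (λ _ → c) [q]≠0 [c']≠0 [cq⁻ⁿ]≠0 (λ _ _ → [c]≠0)
               (lowerReciprocal q c n q≠0 c≠0 [q]≠0 [c]≠0 [cq⁻ⁿ]≠0 [q/c]≠0)

  raising : Φ⁴ q a b (c * (q ^ n)) c' ≋ sumSeries n (λ k → raiseCoeff q c n k · substX q k (Φ⁴ q a b (c * q ^ k) c'))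
  raising m l = trans (expansion m l) (*-identityˡ _)
    where
    expansion : Φ⁴ q a b (c * (q ^ n)) c' ≋ 1# · sumSeries n (λ k → raiseCoeff q c n k · substX q k (Φ⁴ q a b (c * q ^ k) c'))
    expansion = Φ⁴-expansion q a b _ c' n 1# (raiseCoeff q c n) (λ k → c * q ^ k) [q]≠0 [c']≠0 ([cqᵏ]≠0 n NP.≤-refl) [cqᵏ]≠0
                  (λ m → trans (raiseReciprocal q c n [q]≠0 [cqᵏ]≠0 m) (sym (*-identityˡ _)))
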